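{- For any positive integer $g$, the number of numerical semigroups $\Lambda$ with genus $g$ satisfying $f(\Lambda) < 2 m(\Lambda)$ is $F_{g+1}$.
   Context: A numerical semigroup is a subset $\Lambda\subset\mathbb{N}_0$ closed under addition, containing $0$, with finite complement in $\mathbb{N}_0$. Its multiplicity $m(\Lambda)$ is its smallest nonzero element, its Frobenius number $f(\Lambda)$ is the largest element of $\mathbb{N}_0\setminus\Lambda$, and its genus is $|\mathbb{N}_0\setminus\Lambda|$. $F_n$ denotes the Fibonacci numbers: $F_1=F_2=1$, $F_{n+2}=F_{n+1}+F_n$. -}

module Defs where

open import Data.Nat using (ℕ; zero; suc; _+_; _*_; _<_; _≤_)
open import Data.List using (List; length)
open import Data.List.Membership.Propositional using (_∈_; _∉_)
open import Data.List.Relation.Unary.Linked using (Linked)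
open import Data.Product using (_×_; ∃₂)

F : ℕ → ℕ
F zero = 0
F (suc zero) = 1
F (suc (suc n)) = F (suc n) + F n

-- A subset Λ ⊆ ℕ with finite complement is represented by its complement
-- (gap set) G, a strictly increasing list (so each finite set has exactly one
-- representative).  Membership in Λ:
_∈Λ_ : ℕ → List ℕ → Set
x ∈Λ G = x ∉ G

IsNumericalSemigroupGaps : List ℕ → Set
IsNumericalSemigroupGaps G =
  Linked _<_ G × (0 ∈Λ G) × (∀ a b → a ∈Λ G → b ∈Λ G → (a + b) ∈Λ G)

genus : List ℕ → ℕ
genus G = length G

IsMultiplicity : List ℕ → ℕ → Set
IsMultiplicity G m = (0 < m) × (m ∈Λ G) × (∀ k → 0 < k → k < m → k ∈ G)

IsFrobenius : List ℕ → ℕ → Set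
IsFrobenius G f = (f ∈ G) × (∀ x → x ∈ G → x ≤ f)

FrobLessTwiceMult : List ℕ → Set
FrobLessTwiceMult G = ∃₂ λ f m → IsFrobenius G f × IsMultiplicity G m × (f < 2 * m)

module Submission where

-- A numerical semigroup with multiplicity m and Frobenius number f < 2m has
-- as gaps all of 1, …, m − 1 together with an arbitrary subset S of
-- m + 1, …, 2m − 1: conversely every such set is closed under addition, since
-- the sum of two nonzero elements is at least 2m. Encoding S by a bit string
-- of length m − 1, the genus is (m − 1) + |S|, i.e. the bit string counted with
-- weight 1 per false and 2 per true. So these semigroups of genus g
-- correspond to compositions of g into parts 1 and 2, of which there are
-- F (g + 1).

open import Defs
open import Data.Bool using (Bool; true; false)
open import Data.Empty using (⊥-elim)
open import Data.List using (List; []; _∷_; _++_; length; map; applyUpTo)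
open import Data.List.Extrema.Nat using (max; argmax-sel; v≤max⁺; xs≤max)
open import Data.List.Membership.Propositional using (_∈_; _∉_)
open import Data.List.Membership.Propositional.Properties
  using (∈-map⁺; ∈-map⁻; ∈-++⁺ˡ; ∈-++⁺ʳ; ∈-++⁻; ∈-applyUpTo⁺; ∈-applyUpTo⁻)
open import Data.List.Properties using (length-++; length-map; length-applyUpTo; ++-cancelˡ; ∷-injectiveʳ)
open import Data.List.Relation.Binary.Subset.Propositional using (_⊆_)
open import Data.List.Relation.Unary.All as All using ([])
open import Data.List.Relation.Unary.AllPairs using (AllPairs; []; _∷_)
import Data.List.Relation.Unary.AllPairs.Properties as AllPairs
open import Data.List.Relation.Unary.Any using (here; there)
open import Data.List.Relation.Unary.Linked.Properties using (AllPairs⇒Linked; Linked⇒AllPairs)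
open import Data.List.Relation.Unary.Unique.Propositional using (Unique)
import Data.List.Relation.Unary.Unique.Propositional.Properties as Unique
open import Data.Nat using (ℕ; zero; suc; _+_; _*_; _<_; _≤_; _≤?_; z≤n; s≤s)
open import Data.Nat.Properties
open import Data.List.Membership.DecPropositional _≟_ using (_∈?_)
open import Data.Product using (∃; _×_; _,_; proj₁)
open import Data.Sum using (inj₁; inj₂)
open import Relation.Binary.Definitions using (Asymmetric; tri<; tri≈; tri>)
open import Relation.Binary.PropositionalEquality
  using (_≡_; refl; sym; trans; cong; cong₂; subst; module ≡-Reasoning)
open import Relation.Nullary using (¬_; yes; no; does)

weight : List Bool → ℕ
weight [] = 0
weight (false ∷ bs) = 1 + weight bs
weight (true ∷ bs) = 2 + weight bs

compositions : ℕ → List (List Bool)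
compositions zero = [] ∷ []
compositions (suc zero) = (false ∷ []) ∷ []
compositions (suc (suc n)) =
  map (false ∷_) (compositions (suc n)) ++ map (true ∷_) (compositions n)

length-compositions : ∀ n → length (compositions n) ≡ F (suc n)
length-compositions zero = refl
length-compositions (suc zero) = refl
length-compositions (suc (suc n)) = begin
  length (map (false ∷_) (compositions (suc n)) ++ map (true ∷_) (compositions n))
    ≡⟨ length-++ (map (false ∷_) (compositions (suc n))) ⟩
  length (map (false ∷_) (compositions (suc n))) + length (map (true ∷_) (compositions n))
    ≡⟨ cong₂ _+_ (length-map _ (compositions (suc n))) (length-map _ (compositions n)) ⟩
  length (compositions (suc n)) + length (compositions n)
    ≡⟨ cong₂ _+_ (length-compositions (suc n)) (length-compositions n) ⟩
  F (suc (suc n)) + F (suc n) ∎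
  where open ≡-Reasoning

∈-compositions⁺ : ∀ bs → bs ∈ compositions (weight bs)
∈-compositions⁺ [] = here refl
∈-compositions⁺ (false ∷ []) = here refl
∈-compositions⁺ (false ∷ false ∷ bs) =
  ∈-++⁺ˡ (∈-map⁺ (false ∷_) (∈-compositions⁺ (false ∷ bs)))
∈-compositions⁺ (false ∷ true ∷ bs) =
  ∈-++⁺ˡ (∈-map⁺ (false ∷_) (∈-compositions⁺ (true ∷ bs)))
∈-compositions⁺ (true ∷ bs) =
  ∈-++⁺ʳ (map (false ∷_) (compositions (suc (weight bs)))) (∈-map⁺ (true ∷_) (∈-compositions⁺ bs))

∈-compositions⁻ : ∀ n {bs} → bs ∈ compositions n → weight bs ≡ n
∈-compositions⁻ zero (here refl) = refl
∈-compositions⁻ (suc zero) (here refl) = refl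
∈-compositions⁻ (suc (suc n)) p with ∈-++⁻ (map (false ∷_) (compositions (suc n))) p
... | inj₁ q with _ , r , refl ← ∈-map⁻ (false ∷_) q = cong suc (∈-compositions⁻ (suc n) r)
... | inj₂ q with _ , r , refl ← ∈-map⁻ (true ∷_) q = cong (2 +_) (∈-compositions⁻ n r)

compositions-unique : ∀ n → Unique (compositions n)
compositions-unique zero = [] ∷ []
compositions-unique (suc zero) = [] ∷ []
compositions-unique (suc (suc n)) =
  Unique.++⁺ (Unique.map⁺ ∷-injectiveʳ (compositions-unique (suc n)))
             (Unique.map⁺ ∷-injectiveʳ (compositions-unique n))
             headsDiffer
  where
  headsDiffer : ∀ {bs} → ¬ (bs ∈ map (false ∷_) (compositions (suc n)) × bs ∈ map (true ∷_) (compositions n))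
  headsDiffer (p , q) with ∈-map⁻ (false ∷_) p | ∈-map⁻ (true ∷_) q
  ... | _ , _ , refl | _ , _ , ()

AllPairs-⊆-antisym : ∀ {A : Set} {R : A → A → Set} → Asymmetric R →
  ∀ {xs ys} → AllPairs R xs → AllPairs R ys → xs ⊆ ys → ys ⊆ xs → xs ≡ ys
AllPairs-⊆-antisym asym [] [] _ _ = refl
AllPairs-⊆-antisym asym [] (_ ∷ _) _ ys⊆xs with () ← ys⊆xs (here refl)
AllPairs-⊆-antisym asym (_ ∷ _) [] xs⊆ys _ with () ← xs⊆ys (here refl)
AllPairs-⊆-antisym {R = R} asym {x ∷ xs} {y ∷ ys} (Rx ∷ Rxs) (Ry ∷ Rys) xs⊆ys ys⊆xs =
  cong₂ _∷_ x≡y (AllPairs-⊆-antisym asym Rxs Rys tails⊆ tails⊇)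
  where
  irrefl : ∀ {z} → ¬ R z z
  irrefl r = asym r r
  x≡y : x ≡ y
  x≡y with xs⊆ys (here refl) | ys⊆xs (here refl)
  ... | here x≡y | _ = x≡y
  ... | there _ | here y≡x = sym y≡x
  ... | there x∈ys | there y∈xs = ⊥-elim (asym (All.lookup Ry x∈ys) (All.lookup Rx y∈xs))
  tails⊆ : xs ⊆ ys
  tails⊆ z∈xs with xs⊆ys (there z∈xs)
  ... | here refl = ⊥-elim (irrefl (subst (λ w → R w y) x≡y (All.lookup Rx z∈xs)))
  ... | there z∈ys = z∈ys
  tails⊇ : ys ⊆ xs
  tails⊇ z∈ys with ys⊆xs (there z∈ys)
  ... | here refl = ⊥-elim (irrefl (subst (λ w → R w x) (sym x≡y) (All.lookup Ry z∈ys)))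
  ... | there z∈xs = z∈xs

max-isFrobenius : ∀ x xs → IsFrobenius (x ∷ xs) (max x xs)
max-isFrobenius x xs = max∈ , ≤max
  where
  max∈ : max x xs ∈ x ∷ xs
  max∈ with argmax-sel (λ y → y) x xs
  ... | inj₁ max≡x = here max≡x
  ... | inj₂ max∈xs = there max∈xs
  ≤max : ∀ y → y ∈ x ∷ xs → y ≤ max x xs
  ≤max y (here refl) = v≤max⁺ x xs (inj₁ ≤-refl)
  ≤max y (there y∈xs) = All.lookup (xs≤max x xs) y∈xs

frobLessTwiceMult⁺ : ∀ {x xs} m → IsMultiplicity (x ∷ xs) m →
  (∀ {y} → y ∈ x ∷ xs → y < 2 * m) → FrobLessTwiceMult (x ∷ xs)
frobLessTwiceMult⁺ {x} {xs} m isMult gaps<2m =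
  max x xs , m , max-isFrobenius x xs , isMult , gaps<2m (proj₁ (max-isFrobenius x xs))

-- The sum of two nonzero elements of Λ is at least 2m, beyond every gap.
gaps<2m⇒+-closed : ∀ {G} m → (∀ k → 0 < k → k < m → k ∈ G) → (∀ {x} → x ∈ G → x < 2 * m) →
  ∀ a b → a ∈Λ G → b ∈Λ G → (a + b) ∈Λ G
gaps<2m⇒+-closed m below gaps<2m zero b _ b∈Λ = b∈Λ
gaps<2m⇒+-closed {G} m below gaps<2m (suc a) zero a∈Λ _ = subst (_∈Λ G) (sym (+-identityʳ (suc a))) a∈Λ
gaps<2m⇒+-closed {G} m below gaps<2m (suc a) (suc b) a∈Λ b∈Λ a+b∈G =
  <⇒≱ (gaps<2m a+b∈G) (begin
    2 * m           ≡⟨ cong (m +_) (+-identityʳ m) ⟩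
    m + m           ≤⟨ +-mono-≤ (≥m a∈Λ) (≥m b∈Λ) ⟩
    suc a + suc b   ∎)
  where
  open ≤-Reasoning
  ≥m : ∀ {k} → suc k ∈Λ G → m ≤ suc k
  ≥m {k} k∈Λ with m ≤? suc k
  ... | yes m≤k = m≤k
  ... | no m≰k = ⊥-elim (k∈Λ (below (suc k) (s≤s z≤n) (≰⇒> m≰k)))

select : ℕ → List Bool → List ℕ
select k [] = []
select k (true ∷ bs) = k ∷ select (suc k) bs
select k (false ∷ bs) = select (suc k) bs

select-≥ : ∀ {x} k bs → x ∈ select k bs → k ≤ x
select-≥ k (true ∷ bs) (here refl) = ≤-refl
select-≥ k (true ∷ bs) (there p) = <⇒≤ (select-≥ (suc k) bs p)
select-≥ k (false ∷ bs) p = <⇒≤ (select-≥ (suc k) bs p)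

select-< : ∀ {x} k bs → x ∈ select k bs → x < k + length bs
select-< k (true ∷ bs) (here refl) = m<m+n k (s≤s z≤n)
select-< {x} k (true ∷ bs) (there p) = subst (x <_) (sym (+-suc k (length bs))) (select-< (suc k) bs p)
select-< {x} k (false ∷ bs) p = subst (x <_) (sym (+-suc k (length bs))) (select-< (suc k) bs p)

select-sorted : ∀ k bs → AllPairs _<_ (select k bs)
select-sorted k [] = []
select-sorted k (true ∷ bs) = All.tabulate (select-≥ (suc k) bs) ∷ select-sorted (suc k) bs
select-sorted k (false ∷ bs) = select-sorted (suc k) bs

length-select : ∀ k bs → length bs + length (select k bs) ≡ weight bs
length-select k [] = refl
length-select k (false ∷ bs) = cong suc (length-select (suc k) bs)
length-select k (true ∷ bs) = cong suc (trans (+-suc (length bs) _) (cong suc (length-select (suc k) bs)))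

select-injective : ∀ k {bs cs} → length bs ≡ length cs → select k bs ≡ select k cs → bs ≡ cs
select-injective k {[]} {[]} _ _ = refl
select-injective k {true ∷ bs} {true ∷ cs} |bs|≡|cs| eq =
  cong (true ∷_) (select-injective (suc k) (suc-injective |bs|≡|cs|) (∷-injectiveʳ eq))
select-injective k {false ∷ bs} {false ∷ cs} |bs|≡|cs| eq =
  cong (false ∷_) (select-injective (suc k) (suc-injective |bs|≡|cs|) eq)
select-injective k {true ∷ bs} {false ∷ cs} _ eq =
  ⊥-elim (n≮n k (select-≥ (suc k) cs (subst (k ∈_) eq (here refl))))
select-injective k {false ∷ bs} {true ∷ cs} _ eq =
  ⊥-elim (n≮n k (select-≥ (suc k) bs (subst (k ∈_) (sym eq) (here refl))))

bitsOf : List ℕ → ℕ → ℕ → List Bool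
bitsOf G k zero = []
bitsOf G k (suc n) = does (k ∈? G) ∷ bitsOf G (suc k) n

length-bitsOf : ∀ G k n → length (bitsOf G k n) ≡ n
length-bitsOf G k zero = refl
length-bitsOf G k (suc n) = cong suc (length-bitsOf G (suc k) n)

∈-select-bitsOf⁻ : ∀ {x} G k n → x ∈ select k (bitsOf G k n) → x ∈ G
∈-select-bitsOf⁻ G k (suc n) p with k ∈? G | p
... | yes k∈G | here refl = k∈G
... | yes _ | there q = ∈-select-bitsOf⁻ G (suc k) n q
... | no _ | q = ∈-select-bitsOf⁻ G (suc k) n q

∈-select-bitsOf⁺ : ∀ {x} G k n → k ≤ x → x < k + n → x ∈ G → x ∈ select k (bitsOf G k n)
∈-select-bitsOf⁺ {x} G k zero k≤x x<k+0 _ = ⊥-elim (<⇒≱ (subst (x <_) (+-identityʳ k) x<k+0) k≤x)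
∈-select-bitsOf⁺ {x} G k (suc n) k≤x x<k+n x∈G with k ∈? G | m≤n⇒m<n∨m≡n k≤x
... | yes _ | inj₂ refl = here refl
... | no k∉G | inj₂ refl = ⊥-elim (k∉G x∈G)
... | yes _ | inj₁ k<x = there (∈-select-bitsOf⁺ G (suc k) n k<x (subst (x <_) (+-suc k n) x<k+n) x∈G)
... | no _ | inj₁ k<x = ∈-select-bitsOf⁺ G (suc k) n k<x (subst (x <_) (+-suc k n) x<k+n) x∈G

-- gaps j bs = {1, …, j} ∪ {j + 2 + i | bs ! i}, the gaps of a semigroup of multiplicity j + 1.
gaps : ℕ → List Bool → List ℕ
gaps j bs = applyUpTo suc j ++ select (2 + j) bs

gapSet : List Bool → List ℕ
gapSet bs = gaps (length bs) bs

gaps-sorted : ∀ j bs → AllPairs _<_ (gaps j bs)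
gaps-sorted j bs = AllPairs.++⁺ (AllPairs.applyUpTo⁺₁ suc j (λ i<j _ → s≤s i<j)) (select-sorted (2 + j) bs)
  (All.tabulate λ x∈ → All.tabulate λ y∈ → <-≤-trans (below-m x∈) (<⇒≤ (select-≥ (2 + j) bs y∈)))
  where
  below-m : ∀ {x} → x ∈ applyUpTo suc j → x < suc j
  below-m x∈ with _ , i<j , refl ← ∈-applyUpTo⁻ suc x∈ = s≤s i<j

suc∉gaps : ∀ j bs → suc j ∉ gaps j bs
suc∉gaps j bs m∈ with ∈-++⁻ (applyUpTo suc j) m∈
... | inj₁ m∈₁ with _ , i<j , refl ← ∈-applyUpTo⁻ suc m∈₁ = n≮n j i<j
... | inj₂ m∈₂ = n≮n (suc j) (select-≥ (2 + j) bs m∈₂)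

gaps-below : ∀ j bs k → 0 < k → k < suc j → k ∈ gaps j bs
gaps-below j bs (suc i) _ (s≤s i<j) = ∈-++⁺ˡ (∈-applyUpTo⁺ suc i<j)

gaps-isMultiplicity : ∀ j bs → IsMultiplicity (gaps j bs) (suc j)
gaps-isMultiplicity j bs = s≤s z≤n , suc∉gaps j bs , gaps-below j bs

0∉gaps : ∀ j bs → 0 ∉ gaps j bs
0∉gaps j bs 0∈ with ∈-++⁻ (applyUpTo suc j) 0∈
... | inj₁ 0∈₁ with () ← ∈-applyUpTo⁻ suc 0∈₁
... | inj₂ 0∈₂ with () ← select-≥ (2 + j) bs 0∈₂

2*[1+n]≡2+n+n : ∀ n → 2 * suc n ≡ 2 + n + n
2*[1+n]≡2+n+n n = cong suc (trans (cong (n +_) (+-identityʳ (suc n))) (+-suc n n))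

gapSet-<2m : ∀ {x} bs → x ∈ gapSet bs → x < 2 * suc (length bs)
gapSet-<2m {x} bs x∈ = subst (x <_) (sym (2*[1+n]≡2+n+n j)) (gapSet-< x∈)
  where
  j = length bs
  gapSet-< : ∀ {x} → x ∈ gapSet bs → x < 2 + j + j
  gapSet-< x∈ with ∈-++⁻ (applyUpTo suc j) x∈
  ... | inj₁ x∈₁ with _ , i<j , refl ← ∈-applyUpTo⁻ suc x∈₁ = s≤s (≤-trans i<j (m≤n⇒m≤1+n (m≤m+n j j)))
  ... | inj₂ x∈₂ = select-< (2 + j) bs x∈₂

length-gapSet : ∀ bs → length (gapSet bs) ≡ weight bs
length-gapSet bs = begin
  length (applyUpTo suc j ++ select (2 + j) bs)  ≡⟨ length-++ (applyUpTo suc j) ⟩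
  length (applyUpTo suc j) + length (select (2 + j) bs)  ≡⟨ cong (_+ length (select (2 + j) bs)) (length-applyUpTo suc j) ⟩
  j + length (select (2 + j) bs)  ≡⟨ length-select (2 + j) bs ⟩
  weight bs ∎
  where
  open ≡-Reasoning
  j = length bs

-- The multiplicity suc (length bs) is recovered as the least positive non-gap.
gapSet-injective : ∀ {bs cs} → gapSet bs ≡ gapSet cs → bs ≡ cs
gapSet-injective {bs} {cs} eq with <-cmp (length bs) (length cs)
... | tri< |bs|<|cs| _ _ = ⊥-elim (suc∉gaps _ bs
        (subst (suc (length bs) ∈_) (sym eq) (gaps-below _ cs _ (s≤s z≤n) (s≤s |bs|<|cs|))))
... | tri> _ _ |cs|<|bs| = ⊥-elim (suc∉gaps _ cs
        (subst (suc (length cs) ∈_) eq (gaps-below _ bs _ (s≤s z≤n) (s≤s |cs|<|bs|))))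
... | tri≈ _ |bs|≡|cs| _ = select-injective _ |bs|≡|cs|
        (++-cancelˡ (applyUpTo suc (length bs)) _ _
          (trans eq (cong (λ j → gaps j cs) (sym |bs|≡|cs|))))

gapSet-isNumericalSemigroupGaps : ∀ bs → IsNumericalSemigroupGaps (gapSet bs)
gapSet-isNumericalSemigroupGaps bs =
  AllPairs⇒Linked (gaps-sorted j bs) , 0∉gaps j bs ,
  gaps<2m⇒+-closed (suc j) (gaps-below j bs) (gapSet-<2m bs)
  where j = length bs

gapSet-frobLessTwiceMult : ∀ b bs → FrobLessTwiceMult (gapSet (b ∷ bs))
gapSet-frobLessTwiceMult b bs =
  frobLessTwiceMult⁺ _ (gaps-isMultiplicity _ (b ∷ bs)) (gapSet-<2m (b ∷ bs))

gaps-bitsOf : ∀ {G} j → IsNumericalSemigroupGaps G → IsMultiplicity G (suc j) →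
  (∀ {x} → x ∈ G → x < 2 * suc j) → gaps j (bitsOf G (2 + j) j) ≡ G
gaps-bitsOf {G} j (sorted , 0∉G , _) (_ , m∉G , below) gaps<2m =
  AllPairs-⊆-antisym <-asym (gaps-sorted j (bitsOf G (2 + j) j)) (Linked⇒AllPairs <-trans sorted) ⊆G G⊆
  where
  ⊆G : gaps j (bitsOf G (2 + j) j) ⊆ G
  ⊆G x∈ with ∈-++⁻ (applyUpTo suc j) x∈
  ... | inj₁ x∈₁ with _ , i<j , refl ← ∈-applyUpTo⁻ suc x∈₁ = below _ (s≤s z≤n) (s≤s i<j)
  ... | inj₂ x∈₂ = ∈-select-bitsOf⁻ G (2 + j) j x∈₂
  G⊆ : G ⊆ gaps j (bitsOf G (2 + j) j)
  G⊆ {zero} 0∈G = ⊥-elim (0∉G 0∈G)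
  G⊆ {suc i} i+1∈G with <-cmp i j
  ... | tri< i<j _ _ = gaps-below j (bitsOf G (2 + j) j) (suc i) (s≤s z≤n) (s≤s i<j)
  ... | tri≈ _ refl _ = ⊥-elim (m∉G i+1∈G)
  ... | tri> _ _ j<i = ∈-++⁺ʳ (applyUpTo suc j)
          (∈-select-bitsOf⁺ G (2 + j) j (s≤s j<i) (subst (suc i <_) (2*[1+n]≡2+n+n j) (gaps<2m i+1∈G)) i+1∈G)

SmallFrobeniusOfGenus : ℕ → List ℕ → Set
SmallFrobeniusOfGenus g G = IsNumericalSemigroupGaps G × genus G ≡ g × FrobLessTwiceMult G

gapSet-sound : ∀ g → 1 ≤ g → ∀ {G} → G ∈ map gapSet (compositions g) → SmallFrobeniusOfGenus g G
gapSet-sound g 1≤g G∈ with bs , bs∈ , refl ← ∈-map⁻ gapSet G∈ with bs | ∈-compositions⁻ g bs∈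
... | [] | refl = ⊥-elim (<-irrefl refl 1≤g)
... | b ∷ bs′ | weight≡g =
  gapSet-isNumericalSemigroupGaps (b ∷ bs′) , trans (length-gapSet (b ∷ bs′)) weight≡g , gapSet-frobLessTwiceMult b bs′

gapSet-complete : ∀ g {G} → SmallFrobeniusOfGenus g G → G ∈ map gapSet (compositions g)
gapSet-complete g {G} (isNSG , genus≡g , _ , suc j , (_ , ≤f) , isMult , f<2m) =
  subst (_∈ map gapSet (compositions g)) gapSet≡G (∈-map⁺ gapSet bs∈)
  where
  bs = bitsOf G (2 + j) j
  gapSet≡G : gapSet bs ≡ G
  gapSet≡G = trans (cong (λ n → gaps n bs) (length-bitsOf G (2 + j) j))
                   (gaps-bitsOf j isNSG isMult (λ x∈G → ≤-<-trans (≤f _ x∈G) f<2m))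
  bs∈ : bs ∈ compositions g
  bs∈ = subst (λ n → bs ∈ compositions n)
              (trans (sym (length-gapSet bs)) (trans (cong length gapSet≡G) genus≡g))
              (∈-compositions⁺ bs)

proposition2p3 : (g : ℕ) → 1 ≤ g →
    ∃ λ (L : List (List ℕ)) →
      Unique L
      × (∀ G → (G ∈ L →
                 IsNumericalSemigroupGaps G × genus G ≡ g × FrobLessTwiceMult G)
             × (IsNumericalSemigroupGaps G × genus G ≡ g × FrobLessTwiceMult G →
                 G ∈ L))
      × length L ≡ F (suc g)
proposition2p3 g 1≤g =
  map gapSet (compositions g) ,
  Unique.map⁺ gapSet-injective (compositions-unique g) ,
  (λ G → gapSet-sound g 1≤g , gapSet-complete g) ,
  trans (length-map gapSet (compositions g)) (length-compositions g)
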